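{- Let $a,b,c,d\in\mathbb{N}$ be square-free with $4abc-d^2\ne0$, such that $d$ is divisible by $a$, $b$ and $c$, and such that none of $d^2-4abc$, $a(d^2-4abc)$, $b(d^2-4abc)$, $c(d^2-4abc)$ is the square of an integer. Let $f(x,y,z)=ax^2+by^2+cz^2-dxyz-1$ and let $S$ be the set of prime divisors of $2abcd(d^2-4abc)$. Then for every prime $p\notin S$, \[\frac{\nu(p)}{p^2}=1+\frac1p\left(\frac{d^2-4abc}{p}\right)\left(1+\left(\frac ap\right)+\left(\frac bp\right)+\left(\frac cp\right)\right)+\frac1{p^2}.\]
   Context: $\nu(p)=\#\{\mathbf{x}\in\mathbb{F}_p^3:f(\mathbf{x})=0\}$, and $(\frac{\cdot}{p})$ is the Legendre symbol. -}

module Defs where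

open import Data.Nat as ℕ using (ℕ; suc)
open import Data.Nat.Divisibility as ℕD using (_∣?_)
open import Data.Integer as ℤ using (ℤ; +_; ∣_∣; _-_; _*_; _+_)
open import Data.List using (List; length; filterᵇ; upTo; concatMap; map)
open import Data.Bool.ListAction using (any)
open import Data.Product using (_×_; _,_)
open import Data.Bool using (Bool; if_then_else_)
open import Relation.Nullary using (does)
open import Relation.Binary.PropositionalEquality using (_≡_)

-- square-free natural number: the only square dividing n is 1
-- (so 0 is not square-free).
SquareFree : ℕ → Set
SquareFree n = ∀ (m : ℕ) → (m ℕ.* m) ℕD.∣ n → m ≡ 1

divides? : ℕ → ℤ → Bool
divides? p x = does (p ∣? ∣ x ∣)

legendre : ℤ → ℕ → ℤ
legendre x p =
  if divides? p x then + 0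
  else if any (λ y → divides? p ((+ y) * (+ y) - x)) (upTo p) then + 1
  else ℤ.-[1+ 0 ]

f : ℤ → ℤ → ℤ → ℤ → ℤ → ℤ → ℤ → ℤ
f a b c d x y z = a * x * x + b * y * y + c * z * z - d * x * y * z - + 1

-- all triples in {0,…,p-1}^3, a set of representatives of F_p^3
triples : ℕ → List (ℕ × ℕ × ℕ)
triples p = concatMap (λ x → concatMap (λ y → map (λ z → (x , y , z)) (upTo p)) (upTo p)) (upTo p)

ν : ℤ → ℤ → ℤ → ℤ → ℕ → ℕ
ν a b c d p = length (filterᵇ (λ { (x , y , z) → divides? p (f a b c d (+ x) (+ y) (+ z)) }) (triples p))

-- Read f = 0 as a quadratic equation in x with leading coefficient a: for fixed y, z it has
-- 1 + χ(Δ(z) y² + M(z)) solutions mod p, where Δ(z) = d²z² − 4ab, M(z) = 4a(1 − cz²) and χ is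
-- the Legendre symbol. Summing over y with Σ_y χ(A y² + B) = −χ(A) + p([B ≡ 0] χ(A) + [A ≡ 0] χ(B))
-- leaves three sums over z. First, Σ_z χ(Δ(z)) = −χ(d²) = −1, because Δ is a quadratic polynomial
-- with nonzero discriminant. Second, where M(z) ≡ 0 we have cz² ≡ 1, so c²Δ(z) ≡ cD with
-- D = d² − 4abc, and there are 1 + χ(c) such z. Third, where Δ(z) ≡ 0 we have d²z² ≡ 4ab, so
-- d²M(z) ≡ 4aD, and there are 1 + χ(ab) such z. All the character sums used come from
-- Σ_t χ(t) = 0, the multiplicativity of χ and Jacobsthal's Σ_s χ(s² − δ) = −1 for δ ≢ 0. These in
-- turn follow by counting square roots and substituting t ↦ ut + v and t ↦ t⁻¹ in sums over ℤ/p.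

module Submission where

open import Defs
open import Data.Nat as ℕ using (ℕ)
open import Data.Nat.Primality using (Prime)
open import Data.Nat.Divisibility as ℕD using ()
open import Data.Integer as ℤ using (ℤ; +_; ∣_∣; _-_; _*_; _+_)
open import Data.Integer.Divisibility as ℤD using ()
open import Data.Product using (∃)
open import Relation.Binary.PropositionalEquality using (_≡_; _≢_)
open import Relation.Nullary using (¬_)

open import Data.Bool using (Bool; true; false; T)
open import Data.Unit using (tt)
open import Data.Bool.ListAction using (any)
open import Data.Integer using (-_; 0ℤ; 1ℤ; -1ℤ; _≤_; +≤+; -≤+)
import Data.Integer.Properties as ℤP
open import Data.Integer.DivMod using (_%ℕ_; _/ℕ_; n%ℕd<d; a≡a%ℕn+[a/ℕn]*n)
open import Data.Integer.Divisibility.Signed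
  using (_∣_; divides; ∣m∣n⇒∣m+n; ∣m⇒∣-m; ∣m⇒∣m*n; ∣n⇒∣m*n; ∣ᵤ⇒∣; ∣⇒∣ᵤ)
  renaming (_∣?_ to _∣ℤ?_)
open import Data.Integer.Tactic.RingSolver using (solve-∀)
open import Data.List using (List; _∷_; _++_; length; filterᵇ; concatMap; map; applyUpTo; upTo)
open import Data.List.Membership.Propositional using (lose)
open import Data.List.Membership.Propositional.Properties using (∈-upTo⁺)
open import Data.List.Properties using (filter-++; length-++)
open import Data.List.Relation.Unary.Any using (satisfied)
open import Data.List.Relation.Unary.Any.Properties using (any⁺; any⁻)
open import Data.Nat using (zero; suc; z≤n; z<s; s<s)
import Data.Nat.Properties as ℕP
open import Data.Nat.Coprimality using (prime⇒coprime; coprime-Bézout)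
open import Data.Nat.DivMod using (m<n⇒m%n≡m)
open import Data.Nat.GCD using (module Bézout)
open import Data.Nat.Primality using (euclidsLemma; prime⇒nonZero; ¬prime[1])
open import Data.Product using (_×_; _,_; proj₁; proj₂)
open import Data.Sum using (_⊎_; [_,_]′)
import Data.Sum as Sum
open import Function using (_∘_)
open import Level using (0ℓ)
open import Relation.Binary.Bundles using (Setoid)
open import Relation.Binary.Core using (_Preserves_⟶_)
open import Relation.Binary.PropositionalEquality
  using (refl; sym; trans; cong; cong₂; subst; module ≡-Reasoning)
import Relation.Binary.Reasoning.Setoid as SetoidReasoning
open import Relation.Nullary using (Dec; yes; no; contradiction)
import Relation.Nullary.Decidable as Dec
open import Relation.Nullary.Decidable using (T?)

-- Finite sums

∑ : ℕ → (ℕ → ℤ) → ℤ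
∑ zero    f = 0ℤ
∑ (suc n) f = f 0 + ∑ n (f ∘ suc)

syntax ∑ n (λ i → e) = ∑[ i < n ] e

∑-cong : ∀ n {f g : ℕ → ℤ} → (∀ i → i ℕ.< n → f i ≡ g i) → ∑ n f ≡ ∑ n g
∑-cong zero    f≡g = refl
∑-cong (suc n) f≡g = cong₂ _+_ (f≡g 0 z<s) (∑-cong n λ i i<n → f≡g (suc i) (s<s i<n))

∑-zero : ∀ n {f : ℕ → ℤ} → (∀ i → i ℕ.< n → f i ≡ 0ℤ) → ∑ n f ≡ 0ℤ
∑-zero zero    f≡0 = refl
∑-zero (suc n) f≡0 = cong₂ _+_ (f≡0 0 z<s) (∑-zero n λ i i<n → f≡0 (suc i) (s<s i<n))

∑-+ : ∀ n (f g : ℕ → ℤ) → ∑[ i < n ] (f i + g i) ≡ ∑ n f + ∑ n g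
∑-+ zero    f g = refl
∑-+ (suc n) f g =
  trans (cong (_+_ (f 0 + g 0)) (∑-+ n (f ∘ suc) (g ∘ suc))) (interchange (f 0) (g 0) _ _)
  where
  interchange : ∀ a b c d → a + b + (c + d) ≡ a + c + (b + d)
  interchange = solve-∀

∑-neg : ∀ n (f : ℕ → ℤ) → ∑[ i < n ] (- f i) ≡ - ∑ n f
∑-neg zero    f = refl
∑-neg (suc n) f = trans (cong (_+_ (- f 0)) (∑-neg n (f ∘ suc))) (sym (ℤP.neg-distrib-+ (f 0) _))

∑-- : ∀ n (f g : ℕ → ℤ) → ∑[ i < n ] (f i - g i) ≡ ∑ n f - ∑ n g
∑-- n f g = trans (∑-+ n f (-_ ∘ g)) (cong (_+_ (∑ n f)) (∑-neg n g))

∑-*ˡ : ∀ n c (f : ℕ → ℤ) → ∑[ i < n ] (c * f i) ≡ c * ∑ n f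
∑-*ˡ zero    c f = sym (ℤP.*-zeroʳ c)
∑-*ˡ (suc n) c f = trans (cong (_+_ (c * f 0)) (∑-*ˡ n c (f ∘ suc))) (sym (ℤP.*-distribˡ-+ c (f 0) _))

∑-const : ∀ n c → ∑[ _ < n ] c ≡ + n * c
∑-const zero    c = refl
∑-const (suc n) c = trans (cong (_+_ c) (∑-const n c)) (sym (ℤP.suc-* (+ n) c))

∑-single : ∀ n {f : ℕ → ℤ} {r} → r ℕ.< n →
           (∀ i → i ℕ.< n → i ≢ r → f i ≡ 0ℤ) → ∑ n f ≡ f r
∑-single (suc n) {f} {zero} _ off =
  trans (cong (_+_ (f 0)) (∑-zero n λ i i<n → off (suc i) (s<s i<n) λ ())) (ℤP.+-identityʳ (f 0))
∑-single (suc n) {f} {suc r} (s<s r<n) off =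
  trans (cong (_+ ∑ n (f ∘ suc)) (off 0 z<s λ ())) (trans (ℤP.+-identityˡ _)
        (∑-single n r<n λ i i<n i≢r → off (suc i) (s<s i<n) (i≢r ∘ ℕP.suc-injective)))

∑-pair : ∀ n {f : ℕ → ℤ} {r r'} → r ℕ.< n → r' ℕ.< n → r ≢ r' →
         (∀ i → i ℕ.< n → i ≢ r → i ≢ r' → f i ≡ 0ℤ) → ∑ n f ≡ f r + f r'
∑-pair (suc n) {f} {zero}  {zero}    _         _          r≢r' off = contradiction refl r≢r'
∑-pair (suc n) {f} {zero}  {suc r'} _         (s<s r'<n) _    off =
  cong (_+_ (f 0)) (∑-single n r'<n λ i i<n i≢r' →
    off (suc i) (s<s i<n) (λ ()) (i≢r' ∘ ℕP.suc-injective))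
∑-pair (suc n) {f} {suc r} {zero}    (s<s r<n) _          _    off =
  trans (cong (_+_ (f 0)) (∑-single n r<n λ i i<n i≢r →
           off (suc i) (s<s i<n) (i≢r ∘ ℕP.suc-injective) (λ ())))
        (ℤP.+-comm (f 0) _)
∑-pair (suc n) {f} {suc r} {suc r'} (s<s r<n) (s<s r'<n) r≢r' off =
  trans (cong (_+ ∑ n (f ∘ suc)) (off 0 z<s (λ ()) (λ ()))) (trans (ℤP.+-identityˡ _)
        (∑-pair n r<n r'<n (r≢r' ∘ cong suc) λ i i<n i≢r i≢r' →
           off (suc i) (s<s i<n) (i≢r ∘ ℕP.suc-injective) (i≢r' ∘ ℕP.suc-injective)))

∑-comm : ∀ m n (h : ℕ → ℕ → ℤ) → ∑[ i < m ] ∑[ j < n ] h i j ≡ ∑[ j < n ] ∑[ i < m ] h i j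
∑-comm zero    n h = sym (∑-zero n λ _ _ → refl)
∑-comm (suc m) n h = trans (cong (_+_ (∑ n (h 0))) (∑-comm m n (h ∘ suc))) (sym (∑-+ n (h 0) _))

∑³-reverse : ∀ n (h : ℕ → ℕ → ℕ → ℤ) →
             ∑[ x < n ] ∑[ y < n ] ∑[ z < n ] h x y z ≡ ∑[ z < n ] ∑[ y < n ] ∑[ x < n ] h x y z
∑³-reverse n h = begin
  ∑[ x < n ] ∑[ y < n ] ∑[ z < n ] h x y z  ≡⟨ ∑-cong n (λ x _ → ∑-comm n n (h x)) ⟩
  ∑[ x < n ] ∑[ z < n ] ∑[ y < n ] h x y z  ≡⟨ ∑-comm n n _ ⟩
  ∑[ z < n ] ∑[ x < n ] ∑[ y < n ] h x y z  ≡⟨ ∑-cong n (λ z _ → ∑-comm n n λ x y → h x y z) ⟩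
  ∑[ z < n ] ∑[ y < n ] ∑[ x < n ] h x y z  ∎
  where open ≡-Reasoning

nonpos-+-≡0 : ∀ {a b} → a ≤ 0ℤ → b ≤ 0ℤ → a + b ≡ 0ℤ → a ≡ 0ℤ × b ≡ 0ℤ
nonpos-+-≡0 {a} {b} a≤0 b≤0 a+b≡0 =
  a≡0 , trans (sym (ℤP.+-identityˡ b)) (trans (cong (_+ b) (sym a≡0)) a+b≡0)
  where
  a≡0 : a ≡ 0ℤ
  a≡0 = ℤP.≤-antisym a≤0
          (subst (_≤ a) a+b≡0 (subst (a + b ≤_) (ℤP.+-identityʳ a) (ℤP.+-monoʳ-≤ a b≤0)))

∑-nonpos : ∀ n {f : ℕ → ℤ} → (∀ i → i ℕ.< n → f i ≤ 0ℤ) → ∑ n f ≤ 0ℤ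
∑-nonpos zero    f≤0 = ℤP.≤-refl
∑-nonpos (suc n) f≤0 = ℤP.+-mono-≤ (f≤0 0 z<s) (∑-nonpos n λ i i<n → f≤0 (suc i) (s<s i<n))

∑-nonpos-≡0 : ∀ n {f : ℕ → ℤ} → (∀ i → i ℕ.< n → f i ≤ 0ℤ) → ∑ n f ≡ 0ℤ →
              ∀ i → i ℕ.< n → f i ≡ 0ℤ
∑-nonpos-≡0 (suc n) {f} f≤0 ∑≡0 = pointwise
  where
  tail≤0 : ∀ i → i ℕ.< n → f (suc i) ≤ 0ℤ
  tail≤0 i i<n = f≤0 (suc i) (s<s i<n)
  split : f 0 ≡ 0ℤ × ∑ n (f ∘ suc) ≡ 0ℤ
  split = nonpos-+-≡0 (f≤0 0 z<s) (∑-nonpos n tail≤0) ∑≡0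
  pointwise : ∀ i → i ℕ.< suc n → f i ≡ 0ℤ
  pointwise zero    _         = proj₁ split
  pointwise (suc i) (s<s i<n) = ∑-nonpos-≡0 n tail≤0 (proj₂ split) i i<n

-- Counting

𝟙 : Bool → ℤ
𝟙 true  = 1ℤ
𝟙 false = 0ℤ

count : {A : Set} → (A → Bool) → List A → ℤ
count P xs = + length (filterᵇ P xs)

count-++ : ∀ {A : Set} (P : A → Bool) xs ys → count P (xs ++ ys) ≡ count P xs + count P ys
count-++ P xs ys = trans (cong (+_ ∘ length) (filter-++ (T? ∘ P) xs ys))
                         (trans (cong +_ (length-++ (filterᵇ P xs)))
                                (ℤP.pos-+ (length (filterᵇ P xs)) (length (filterᵇ P ys))))

count-∷ : ∀ {A : Set} (P : A → Bool) x xs → count P (x ∷ xs) ≡ 𝟙 (P x) + count P xs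
count-∷ P x xs with P x
... | true  = refl
... | false = refl

count-concatMap : ∀ {A B : Set} (P : A → Bool) (G : B → List A) (g : ℕ → B) n →
                  count P (concatMap G (applyUpTo g n)) ≡ ∑[ i < n ] count P (G (g i))
count-concatMap P G g zero    = refl
count-concatMap P G g (suc n) =
  trans (count-++ P (G (g 0)) _) (cong (_+_ (count P (G (g 0)))) (count-concatMap P G (g ∘ suc) n))

count-map : ∀ {A : Set} (P : A → Bool) (H : ℕ → A) (g : ℕ → ℕ) n →
            count P (map H (applyUpTo g n)) ≡ ∑[ i < n ] 𝟙 (P (H (g i)))
count-map P H g zero    = refl
count-map P H g (suc n) =
  trans (count-∷ P (H (g 0)) _) (cong (_+_ (𝟙 (P (H (g 0))))) (count-map P H (g ∘ suc) n))

count-triples : ∀ (P : ℕ × ℕ × ℕ → Bool) n →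
                count P (triples n) ≡ ∑[ x < n ] ∑[ y < n ] ∑[ z < n ] 𝟙 (P (x , y , z))
count-triples P n =
  trans (count-concatMap P _ (λ i → i) n) (∑-cong n λ x _ →
  trans (count-concatMap P _ (λ i → i) n) (∑-cong n λ y _ →
  count-map P (λ z → x , y , z) (λ i → i) n))

-- Arithmetic modulo a prime

module ModuloPrime (p : ℕ) (p-prime : Prime p) where

  instance
    p-nonZero : ℕ.NonZero p
    p-nonZero = prime⇒nonZero p-prime

  infix 4 _≈_ _≉_ _≈?_

  record _≈_ (x y : ℤ) : Set where
    constructor congruent
    field p∣x-y : + p ∣ x - y

  open _≈_

  _≉_ : ℤ → ℤ → Set
  x ≉ y = ¬ x ≈ y

  _≈?_ : ∀ x y → Dec (x ≈ y)
  x ≈? y = Dec.map′ congruent p∣x-y (+ p ∣ℤ? x - y)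

  ≈-reflexive : ∀ {x y} → x ≡ y → x ≈ y
  ≈-reflexive {x} refl = congruent (divides 0ℤ (ℤP.+-inverseʳ x))

  ≈-refl : ∀ {x} → x ≈ x
  ≈-refl = ≈-reflexive refl

  ≈-sym : ∀ {x y} → x ≈ y → y ≈ x
  ≈-sym {x} {y} (congruent p∣x-y) = congruent (subst (+ p ∣_) (negate-difference x y) (∣m⇒∣-m p∣x-y))
    where
    negate-difference : ∀ x y → - (x - y) ≡ y - x
    negate-difference = solve-∀

  ≈-trans : ∀ {x y z} → x ≈ y → y ≈ z → x ≈ z
  ≈-trans {x} {y} {z} (congruent p∣x-y) (congruent p∣y-z) =
    congruent (subst (+ p ∣_) (telescope x y z) (∣m∣n⇒∣m+n p∣x-y p∣y-z))
    where
    telescope : ∀ x y z → (x - y) + (y - z) ≡ x - z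
    telescope = solve-∀

  +-cong : ∀ {x y u v} → x ≈ y → u ≈ v → x + u ≈ y + v
  +-cong {x} {y} {u} {v} (congruent p∣x-y) (congruent p∣u-v) =
    congruent (subst (+ p ∣_) (regroup x y u v) (∣m∣n⇒∣m+n p∣x-y p∣u-v))
    where
    regroup : ∀ x y u v → (x - y) + (u - v) ≡ (x + u) - (y + v)
    regroup = solve-∀

  *-cong : ∀ {x y u v} → x ≈ y → u ≈ v → x * u ≈ y * v
  *-cong {x} {y} {u} {v} (congruent p∣x-y) (congruent p∣u-v) =
    congruent (subst (+ p ∣_) (regroup x y u v)
                     (∣m∣n⇒∣m+n (∣m⇒∣m*n u p∣x-y) (∣n⇒∣m*n y p∣u-v)))
    where
    regroup : ∀ x y u v → (x - y) * u + y * (u - v) ≡ x * u - y * v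
    regroup = solve-∀

  +-congˡ : ∀ z {x y} → x ≈ y → z + x ≈ z + y
  +-congˡ z = +-cong (≈-refl {z})

  +-congʳ : ∀ z {x y} → x ≈ y → x + z ≈ y + z
  +-congʳ z x≈y = +-cong x≈y (≈-refl {z})

  *-congˡ : ∀ z {x y} → x ≈ y → z * x ≈ z * y
  *-congˡ z = *-cong (≈-refl {z})

  *-congʳ : ∀ z {x y} → x ≈ y → x * z ≈ y * z
  *-congʳ z x≈y = *-cong x≈y (≈-refl {z})

  -‿cong : ∀ {x y} → x ≈ y → - x ≈ - y
  -‿cong {x} {y} (congruent p∣x-y) = congruent (subst (+ p ∣_) (regroup x y) (∣m⇒∣-m p∣x-y))
    where
    regroup : ∀ x y → - (x - y) ≡ - x - - y
    regroup = solve-∀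

  ≈-setoid : Setoid 0ℓ 0ℓ
  ≈-setoid = record
    { Carrier       = ℤ
    ; _≈_           = _≈_
    ; isEquivalence = record { refl = ≈-refl ; sym = ≈-sym ; trans = ≈-trans }
    }

  module ≈-Reasoning = SetoidReasoning ≈-setoid

  ≈0⇒∣ : ∀ {x} → x ≈ 0ℤ → + p ∣ x
  ≈0⇒∣ {x} (congruent p∣x-0) = subst (+ p ∣_) (ℤP.+-identityʳ x) p∣x-0

  ∣⇒≈0 : ∀ {x} → + p ∣ x → x ≈ 0ℤ
  ∣⇒≈0 {x} p∣x = congruent (subst (+ p ∣_) (sym (ℤP.+-identityʳ x)) p∣x)

  multiple≈0 : ∀ k → k * + p ≈ 0ℤ
  multiple≈0 k = ∣⇒≈0 (divides k refl)

  1≉0 : 1ℤ ≉ 0ℤ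
  1≉0 1≈0 = ¬prime[1] (subst Prime (ℕD.∣1⇒≡1 (∣⇒∣ᵤ (≈0⇒∣ 1≈0))) p-prime)

  *-≈0ˡ : ∀ {x} y → x ≈ 0ℤ → x * y ≈ 0ℤ
  *-≈0ˡ y x≈0 = ∣⇒≈0 (∣m⇒∣m*n y (≈0⇒∣ x≈0))

  *-≈0ʳ : ∀ x {y} → y ≈ 0ℤ → x * y ≈ 0ℤ
  *-≈0ʳ x y≈0 = ∣⇒≈0 (∣n⇒∣m*n x (≈0⇒∣ y≈0))

  ≈0-* : ∀ {x y} → x * y ≈ 0ℤ → x ≈ 0ℤ ⊎ y ≈ 0ℤ
  ≈0-* {x} {y} xy≈0 =
    Sum.map (∣⇒≈0 ∘ ∣ᵤ⇒∣) (∣⇒≈0 ∘ ∣ᵤ⇒∣)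
      (euclidsLemma ∣ x ∣ ∣ y ∣ p-prime
        (subst (p ℕD.∣_) (ℤP.abs-* x y) (∣⇒∣ᵤ (≈0⇒∣ xy≈0))))

  *-≉0 : ∀ {x y} → x ≉ 0ℤ → y ≉ 0ℤ → x * y ≉ 0ℤ
  *-≉0 x≉0 y≉0 = [ x≉0 , y≉0 ]′ ∘ ≈0-*

  *-cancelˡ-≈0 : ∀ {u x} → u ≉ 0ℤ → u * x ≈ 0ℤ → x ≈ 0ℤ
  *-cancelˡ-≈0 u≉0 ux≈0 = Sum.fromInj₂ (λ u≈0 → contradiction u≈0 u≉0) (≈0-* ux≈0)

  *-cancelˡ : ∀ {u x y} → u ≉ 0ℤ → u * x ≈ u * y → x ≈ y
  *-cancelˡ {u} {x} {y} u≉0 ux≈uy =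
    congruent (≈0⇒∣ (*-cancelˡ-≈0 u≉0 (∣⇒≈0 (subst (+ p ∣_) (factor u x y) (p∣x-y ux≈uy)))))
    where
    factor : ∀ u x y → u * x - u * y ≡ u * (x - y)
    factor = solve-∀

  +*-≈0 : ∀ x k {e} → e ≈ 0ℤ → x + k * e ≈ x
  +*-≈0 x k e≈0 = ≈-trans (+-congˡ x (*-≈0ʳ k e≈0)) (≈-reflexive (ℤP.+-identityʳ x))

  +-cancelʳ : ∀ {x y v} → x + v ≈ y + v → x ≈ y
  +-cancelʳ {x} {y} {v} (congruent p∣difference) = congruent (subst (+ p ∣_) (cancel x y v) p∣difference)
    where
    cancel : ∀ x y v → (x + v) - (y + v) ≡ x - y
    cancel = solve-∀

  square≈0 : ∀ {x} → x * x ≈ 0ℤ → x ≈ 0ℤ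
  square≈0 x²≈0 = Sum.reduce (≈0-* x²≈0)

  rep : ℤ → ℕ
  rep x = x %ℕ p

  rep<p : ∀ x → rep x ℕ.< p
  rep<p x = n%ℕd<d x p

  ≈rep : ∀ x → x ≈ + rep x
  ≈rep x = congruent (divides (x /ℕ p)
    (trans (cong (_- + rep x) (a≡a%ℕn+[a/ℕn]*n x p)) (cancel (+ rep x) _)))
    where
    cancel : ∀ r m → r + m - r ≡ m
    cancel = solve-∀

  0<p : 0 ℕ.< p
  0<p = ℕ.>-nonZero⁻¹ p

  ≈⇒≡ : ∀ {s s'} → s ℕ.< p → s' ℕ.< p → + s ≈ + s' → s ≡ s'
  ≈⇒≡ {s} {s'} s<p s'<p s≈s' =
    ℤP.+-injective (ℤP.i-j≡0⇒i≡j (+ s) (+ s') (ℤP.∣i∣≡0⇒i≡0 ∣s-s'∣≡0))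
    where
    ∣s-s'∣<p : ∣ + s - + s' ∣ ℕ.< p
    ∣s-s'∣<p = ℕP.≤-<-trans
      (subst (ℕ._≤ s ℕ.⊔ s') (cong ∣_∣ (sym (ℤP.[+m]-[+n]≡m⊖n s s'))) (ℤP.∣m⊝n∣≤m⊔n s s'))
      (ℕP.⊔-lub s<p s'<p)
    ∣s-s'∣≡0 : ∣ + s - + s' ∣ ≡ 0
    ∣s-s'∣≡0 = trans (sym (m<n⇒m%n≡m ∣s-s'∣<p)) (ℕD.n∣m⇒m%n≡0 _ p (∣⇒∣ᵤ (p∣x-y s≈s')))

  inverse : ∀ {x} → x ≉ 0ℤ → ∃ λ y → y * x ≈ 1ℤ
  inverse {x} x≉0 = from-residue (rep x) (rep<p x) (≈rep x)
    where
    toℤ : ∀ k m n o → 1 ℕ.+ k ℕ.* m ≡ n ℕ.* o → 1ℤ + + k * + m ≡ + n * + o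
    toℤ k m n o eq =
      trans (cong (_+_ 1ℤ) (sym (ℤP.pos-* k m))) (trans (cong +_ eq) (ℤP.pos-* n o))
    from-residue : ∀ r → r ℕ.< p → x ≈ + r → ∃ λ y → y * x ≈ 1ℤ
    from-residue zero      _   x≈0 = contradiction x≈0 x≉0
    from-residue r@(suc _) r<p x≈r with coprime-Bézout (prime⇒coprime p-prime r<p)
    ... | Bézout.+- u v 1+vr≡up = - + v , (begin
      - + v * x                 ≈⟨ *-congˡ (- + v) x≈r ⟩
      - + v * + r               ≡⟨ negate (+ v) (+ r) ⟩
      1ℤ - (1ℤ + + v * + r)     ≡⟨ cong (λ m → 1ℤ - m) (toℤ v r u p 1+vr≡up) ⟩
      1ℤ - + u * + p            ≈⟨ +-congˡ 1ℤ (-‿cong (multiple≈0 (+ u))) ⟩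
      1ℤ                        ∎)
      where
      open ≈-Reasoning
      negate : ∀ v r → - v * r ≡ 1ℤ - (1ℤ + v * r)
      negate = solve-∀
    ... | Bézout.-+ u v 1+up≡vr = + v , (begin
      + v * x                   ≈⟨ *-congˡ (+ v) x≈r ⟩
      + v * + r                 ≡⟨ sym (toℤ u p v r 1+up≡vr) ⟩
      1ℤ + + u * + p            ≈⟨ +-congˡ 1ℤ (multiple≈0 (+ u)) ⟩
      1ℤ                        ∎)
      where open ≈-Reasoning

  inverse-unique : ∀ {a b x} → a * x ≈ 1ℤ → b * x ≈ 1ℤ → a ≈ b
  inverse-unique {a} {b} {x} ax≈1 bx≈1 = begin
    a                ≡⟨ sym (ℤP.*-identityʳ a) ⟩
    a * 1ℤ           ≈⟨ *-congˡ a bx≈1 ⟨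
    a * (b * x)      ≡⟨ swap a b x ⟩
    b * (a * x)      ≈⟨ *-congˡ b ax≈1 ⟩
    b * 1ℤ           ≡⟨ ℤP.*-identityʳ b ⟩
    b                ∎
    where
    open ≈-Reasoning
    swap : ∀ a b x → a * (b * x) ≡ b * (a * x)
    swap = solve-∀

  -- The inverse modulo p, with the junk value inv x = 0 when p ∣ x.
  inv : ℤ → ℤ
  inv x with x ≈? 0ℤ
  ... | yes _   = 0ℤ
  ... | no x≉0 = proj₁ (inverse x≉0)

  inv-≈0 : ∀ {x} → x ≈ 0ℤ → inv x ≡ 0ℤ
  inv-≈0 {x} x≈0 with x ≈? 0ℤ
  ... | yes _   = refl
  ... | no x≉0 = contradiction x≈0 x≉0

  inv-inverse : ∀ {x} → x ≉ 0ℤ → inv x * x ≈ 1ℤ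
  inv-inverse {x} x≉0 with x ≈? 0ℤ
  ... | yes x≈0 = contradiction x≈0 x≉0
  ... | no x≉0' = proj₂ (inverse x≉0')

  inv-≉0 : ∀ {x} → x ≉ 0ℤ → inv x ≉ 0ℤ
  inv-≉0 {x} x≉0 inv≈0 = 1≉0 (≈-trans (≈-sym (inv-inverse x≉0)) (*-≈0ˡ x inv≈0))

  inv-cong : ∀ {x y} → x ≈ y → inv x ≈ inv y
  inv-cong {x} {y} x≈y = by-cases (x ≈? 0ℤ)
    where
    by-cases : Dec (x ≈ 0ℤ) → inv x ≈ inv y
    by-cases (yes x≈0) = ≈-reflexive (trans (inv-≈0 x≈0) (sym (inv-≈0 (≈-trans (≈-sym x≈y) x≈0))))
    by-cases (no x≉0)  = inverse-unique (≈-trans (*-congˡ (inv x) (≈-sym x≈y)) (inv-inverse x≉0))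
                                        (inv-inverse (x≉0 ∘ ≈-trans x≈y))

  inv-involutive : ∀ x → inv (inv x) ≈ x
  inv-involutive x = by-cases (x ≈? 0ℤ)
    where
    by-cases : Dec (x ≈ 0ℤ) → inv (inv x) ≈ x
    by-cases (yes x≈0) = ≈-trans (≈-reflexive (inv-≈0 (≈-reflexive (inv-≈0 x≈0)))) (≈-sym x≈0)
    by-cases (no x≉0)  = inverse-unique (inv-inverse (inv-≉0 x≉0))
                           (≈-trans (≈-reflexive (ℤP.*-comm x (inv x))) (inv-inverse x≉0))

  𝟙[_≈_] : ℤ → ℤ → ℤ
  𝟙[ x ≈ y ] = 𝟙 (divides? p (x - y))

  𝟙-divides? : ∀ x → 𝟙 (divides? p x) ≡ 𝟙[ x ≈ 0ℤ ]
  𝟙-divides? x = cong (λ e → 𝟙 (divides? p e)) (sym (ℤP.+-identityʳ x))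

  𝟙-≈ : ∀ {x y} → x ≈ y → 𝟙[ x ≈ y ] ≡ 1ℤ
  𝟙-≈ {x} {y} x≈y with p ℕD.∣? ∣ x - y ∣
  ... | yes _   = refl
  ... | no p∤xy = contradiction (∣⇒∣ᵤ (p∣x-y x≈y)) p∤xy

  𝟙-≉ : ∀ {x y} → x ≉ y → 𝟙[ x ≈ y ] ≡ 0ℤ
  𝟙-≉ {x} {y} x≉y with p ℕD.∣? ∣ x - y ∣
  ... | yes p∣xy = contradiction (congruent (∣ᵤ⇒∣ p∣xy)) x≉y
  ... | no _     = refl

  𝟙-cong : ∀ {x y x' y'} → (x ≈ y → x' ≈ y') → (x' ≈ y' → x ≈ y) →
           𝟙[ x ≈ y ] ≡ 𝟙[ x' ≈ y' ]
  𝟙-cong {x} {y} to from with x ≈? y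
  ... | yes x≈y = trans (𝟙-≈ x≈y) (sym (𝟙-≈ (to x≈y)))
  ... | no x≉y  = trans (𝟙-≉ x≉y) (sym (𝟙-≉ (x≉y ∘ from)))

  𝟙-resp : ∀ {x y x' y'} → x ≈ x' → y ≈ y' → 𝟙[ x ≈ y ] ≡ 𝟙[ x' ≈ y' ]
  𝟙-resp x≈x' y≈y' =
    𝟙-cong (λ x≈y → ≈-trans (≈-sym x≈x') (≈-trans x≈y y≈y'))
           (λ x'≈y' → ≈-trans x≈x' (≈-trans x'≈y' (≈-sym y≈y')))

  𝟙-*ˡ : ∀ {x y} g k → (x ≈ y → g ≡ k) → 𝟙[ x ≈ y ] * g ≡ k * 𝟙[ x ≈ y ]
  𝟙-*ˡ {x} {y} g k g≡k with x ≈? y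
  ... | yes x≈y = trans (cong (_* g) (𝟙-≈ x≈y)) (trans (ℤP.*-identityˡ g)
                   (trans (g≡k x≈y) (sym (trans (cong (k *_) (𝟙-≈ x≈y)) (ℤP.*-identityʳ k)))))
  ... | no x≉y  = trans (cong (_* g) (𝟙-≉ x≉y))
                   (sym (trans (cong (k *_) (𝟙-≉ x≉y)) (ℤP.*-zeroʳ k)))

  ∑-𝟙≈0 : ∑[ t < p ] 𝟙[ + t ≈ 0ℤ ] ≡ 1ℤ
  ∑-𝟙≈0 = trans (∑-single p 0<p off) (𝟙-≈ (≈-refl {0ℤ}))
    where
    off : ∀ t → t ℕ.< p → t ≢ 0 → 𝟙[ + t ≈ 0ℤ ] ≡ 0ℤ
    off t t<p t≢0 = 𝟙-≉ (t≢0 ∘ ≈⇒≡ t<p 0<p)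

  T-divides?⇒≈ : ∀ {x y} → T (divides? p (x - y)) → x ≈ y
  T-divides?⇒≈ {x} {y} t with p ℕD.∣? ∣ x - y ∣
  ... | yes p∣x-y = congruent (∣ᵤ⇒∣ p∣x-y)

  ≈⇒T-divides? : ∀ {x y} → x ≈ y → T (divides? p (x - y))
  ≈⇒T-divides? {x} {y} x≈y with p ℕD.∣? ∣ x - y ∣
  ... | yes _    = tt
  ... | no p∤x-y = contradiction (∣⇒∣ᵤ (p∣x-y x≈y)) p∤x-y

  -- The Legendre symbol

  χ : ℤ → ℤ
  χ x = legendre x p

  IsSquare : ℤ → Set
  IsSquare x = ∃ λ y → y * y ≈ x

  data LegendreView (x : ℤ) : ℤ → Set where
    vanishing  : x ≈ 0ℤ → LegendreView x 0ℤ
    residue    : x ≉ 0ℤ → IsSquare x → LegendreView x 1ℤ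
    nonresidue : x ≉ 0ℤ → ¬ IsSquare x → LegendreView x -1ℤ

  legendreView : ∀ x → LegendreView x (χ x)
  legendreView x with p ℕD.∣? ∣ x ∣
  ... | yes p∣x = vanishing (∣⇒≈0 (∣ᵤ⇒∣ p∣x))
  ... | no p∤x with any (λ s → divides? p (+ s * + s - x)) (upTo p) in found
  ...   | true  = residue x≉0 (root (satisfied (any⁻ _ (upTo p) (subst T (sym found) _))))
    where
    x≉0 : x ≉ 0ℤ
    x≉0 = p∤x ∘ ∣⇒∣ᵤ ∘ ≈0⇒∣
    root : (∃ λ s → T (divides? p (+ s * + s - x))) → IsSquare x
    root (s , s-is-root) = + s , T-divides?⇒≈ s-is-root
  ...   | false = nonresidue (p∤x ∘ ∣⇒∣ᵤ ∘ ≈0⇒∣) λ (y , y²≈x) →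
    subst T found (any⁺ _ (lose (∈-upTo⁺ (rep<p y)) (≈⇒T-divides? (reduced-root y y²≈x))))
    where
    reduced-root : ∀ y → y * y ≈ x → + rep y * + rep y ≈ x
    reduced-root y y²≈x = ≈-trans (*-cong (≈-sym (≈rep y)) (≈-sym (≈rep y))) y²≈x

  χ-vanishing : ∀ {x} → x ≈ 0ℤ → χ x ≡ 0ℤ
  χ-vanishing {x} x≈0 with χ x | legendreView x
  ... | _ | vanishing _        = refl
  ... | _ | residue x≉0 _      = contradiction x≈0 x≉0
  ... | _ | nonresidue x≉0 _   = contradiction x≈0 x≉0

  χ-residue : ∀ {x} → x ≉ 0ℤ → IsSquare x → χ x ≡ 1ℤ
  χ-residue {x} x≉0 □x with χ x | legendreView x
  ... | _ | vanishing x≈0      = contradiction x≈0 x≉0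
  ... | _ | residue _ _        = refl
  ... | _ | nonresidue _ ¬□x   = contradiction □x ¬□x

  χ-nonresidue : ∀ {x} → x ≉ 0ℤ → ¬ IsSquare x → χ x ≡ -1ℤ
  χ-nonresidue {x} x≉0 ¬□x with χ x | legendreView x
  ... | _ | vanishing x≈0      = contradiction x≈0 x≉0
  ... | _ | residue _ □x       = contradiction □x ¬□x
  ... | _ | nonresidue _ _     = refl

  χ-cong : χ Preserves _≈_ ⟶ _≡_
  χ-cong {x} {y} x≈y with χ y | legendreView y
  ... | _ | vanishing y≈0 = χ-vanishing (≈-trans x≈y y≈0)
  ... | _ | residue y≉0 (w , w²≈y) =
    χ-residue (y≉0 ∘ ≈-trans (≈-sym x≈y)) (w , ≈-trans w²≈y (≈-sym x≈y))
  ... | _ | nonresidue y≉0 ¬□y =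
    χ-nonresidue (y≉0 ∘ ≈-trans (≈-sym x≈y)) λ (w , w²≈x) → ¬□y (w , ≈-trans w²≈x x≈y)

  χ-1 : χ 1ℤ ≡ 1ℤ
  χ-1 = χ-residue 1≉0 (1ℤ , ≈-refl)

  χ≤1 : ∀ x → χ x ≤ 1ℤ
  χ≤1 x with χ x | legendreView x
  ... | _ | vanishing _    = +≤+ z≤n
  ... | _ | residue _ _    = ℤP.≤-refl
  ... | _ | nonresidue _ _ = -≤+

  χ²≡1 : ∀ {x} → x ≉ 0ℤ → χ x * χ x ≡ 1ℤ
  χ²≡1 {x} x≉0 with χ x | legendreView x
  ... | _ | vanishing x≈0  = contradiction x≈0 x≉0
  ... | _ | residue _ _    = refl
  ... | _ | nonresidue _ _ = refl

  χ-*-square : ∀ w y → w ≉ 0ℤ → χ (w * w * y) ≡ χ y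
  χ-*-square w y w≉0 with χ y | legendreView y
  ... | _ | vanishing y≈0 = χ-vanishing (*-≈0ʳ (w * w) y≈0)
  ... | _ | residue y≉0 (u , u²≈y) = χ-residue w²y≉0 (w * u , (begin
    w * u * (w * u)    ≡⟨ regroup w u ⟩
    w * w * (u * u)    ≈⟨ *-congˡ (w * w) u²≈y ⟩
    w * w * y          ∎))
    where
    open ≈-Reasoning
    w²y≉0 : w * w * y ≉ 0ℤ
    w²y≉0 = *-≉0 (*-≉0 w≉0 w≉0) y≉0
    regroup : ∀ w u → w * u * (w * u) ≡ w * w * (u * u)
    regroup = solve-∀
  ... | _ | nonresidue y≉0 ¬□y = χ-nonresidue (*-≉0 (*-≉0 w≉0 w≉0) y≉0) λ (v , v²≈w²y) →
    ¬□y (inv w * v , (begin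
    inv w * v * (inv w * v)        ≡⟨ regroup (inv w) v ⟩
    inv w * inv w * (v * v)        ≈⟨ *-congˡ (inv w * inv w) v²≈w²y ⟩
    inv w * inv w * (w * w * y)    ≡⟨ regroup′ (inv w) w y ⟩
    inv w * w * (inv w * w) * y    ≈⟨ *-congʳ y (*-cong (inv-inverse w≉0) (inv-inverse w≉0)) ⟩
    1ℤ * 1ℤ * y                    ≡⟨ ℤP.*-identityˡ y ⟩
    y                              ∎))
    where
    open ≈-Reasoning
    regroup : ∀ w u → w * u * (w * u) ≡ w * w * (u * u)
    regroup = solve-∀
    regroup′ : ∀ i w y → i * i * (w * w * y) ≡ i * w * (i * w) * y
    regroup′ = solve-∀

  -- Changes of variables

  ∑-fibres : ∀ {G : ℤ → ℤ} → G Preserves _≈_ ⟶ _≡_ → (h : ℕ → ℤ) →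
             ∑[ s < p ] G (h s) ≡ ∑[ t < p ] (G (+ t) * ∑[ s < p ] 𝟙[ h s ≈ + t ])
  ∑-fibres {G} G-cong h = begin
    ∑[ s < p ] G (h s)
      ≡⟨ ∑-cong p (λ s _ → expand (h s)) ⟩
    ∑[ s < p ] ∑[ t < p ] (G (+ t) * 𝟙[ h s ≈ + t ])
      ≡⟨ ∑-comm p p _ ⟩
    ∑[ t < p ] ∑[ s < p ] (G (+ t) * 𝟙[ h s ≈ + t ])
      ≡⟨ ∑-cong p (λ t _ → ∑-*ˡ p (G (+ t)) _) ⟩
    ∑[ t < p ] (G (+ t) * ∑[ s < p ] 𝟙[ h s ≈ + t ]) ∎
    where
    open ≡-Reasoning
    expand : ∀ x → G x ≡ ∑[ t < p ] (G (+ t) * 𝟙[ x ≈ + t ])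
    expand x = sym (begin
      ∑[ t < p ] (G (+ t) * 𝟙[ x ≈ + t ])  ≡⟨ ∑-single p (rep<p x) off ⟩
      G (+ rep x) * 𝟙[ x ≈ + rep x ]       ≡⟨ cong (G (+ rep x) *_) (𝟙-≈ (≈rep x)) ⟩
      G (+ rep x) * 1ℤ                     ≡⟨ ℤP.*-identityʳ _ ⟩
      G (+ rep x)                          ≡⟨ G-cong (≈rep x) ⟨
      G x                                  ∎)
      where
      off : ∀ t → t ℕ.< p → t ≢ rep x → G (+ t) * 𝟙[ x ≈ + t ] ≡ 0ℤ
      off t t<p t≢r = trans (cong (G (+ t) *_) (𝟙-≉ λ x≈t →
                        t≢r (≈⇒≡ t<p (rep<p x) (≈-trans (≈-sym x≈t) (≈rep x)))))
                      (ℤP.*-zeroʳ (G (+ t)))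

  ∑-permute : ∀ {G : ℤ → ℤ} → G Preserves _≈_ ⟶ _≡_ → (φ : ℕ → ℤ) →
              (∀ {s s'} → s ℕ.< p → s' ℕ.< p → φ s ≈ φ s' → s ≡ s') →
              (∀ {t} → t ℕ.< p → ∃ λ s → s ℕ.< p × φ s ≈ + t) →
              ∑[ s < p ] G (φ s) ≡ ∑[ t < p ] G (+ t)
  ∑-permute {G} G-cong φ injective surjective =
    trans (∑-fibres G-cong φ) (∑-cong p λ t t<p →
      trans (cong (G (+ t) *_) (fibre≡1 t<p)) (ℤP.*-identityʳ (G (+ t))))
    where
    fibre≡1 : ∀ {t} → t ℕ.< p → ∑[ s < p ] 𝟙[ φ s ≈ + t ] ≡ 1ℤ
    fibre≡1 t<p =
      let (s , s<p , φs≈t) = surjective t<p in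
      trans (∑-single p s<p λ s' s'<p s'≢s → 𝟙-≉ λ φs'≈t →
               s'≢s (injective s'<p s<p (≈-trans φs'≈t (≈-sym φs≈t))))
            (𝟙-≈ φs≈t)

  ∑-affine : ∀ {G : ℤ → ℤ} → G Preserves _≈_ ⟶ _≡_ → ∀ {u} v → u ≉ 0ℤ →
             ∑[ s < p ] G (u * + s + v) ≡ ∑[ t < p ] G (+ t)
  ∑-affine G-cong {u} v u≉0 = ∑-permute G-cong (λ s → u * + s + v) injective surjective
    where
    injective : ∀ {s s'} → s ℕ.< p → s' ℕ.< p → u * + s + v ≈ u * + s' + v → s ≡ s'
    injective s<p s'<p us+v≈us'+v = ≈⇒≡ s<p s'<p (*-cancelˡ u≉0 (+-cancelʳ us+v≈us'+v))
    surjective : ∀ {t} → t ℕ.< p → ∃ λ s → s ℕ.< p × u * + s + v ≈ + t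
    surjective {t} t<p = rep x , rep<p x , (begin
      u * + rep x + v            ≈⟨ +-congʳ v (*-congˡ u (≈rep x)) ⟨
      u * (inv u * (+ t - v)) + v  ≡⟨ regroup u (inv u) (+ t) v ⟩
      inv u * u * (+ t - v) + v    ≈⟨ +-congʳ v (*-congʳ (+ t - v) (inv-inverse u≉0)) ⟩
      1ℤ * (+ t - v) + v           ≡⟨ cancel (+ t) v ⟩
      + t                          ∎)
      where
      open ≈-Reasoning
      x : ℤ
      x = inv u * (+ t - v)
      regroup : ∀ u i t v → u * (i * (t - v)) + v ≡ i * u * (t - v) + v
      regroup = solve-∀
      cancel : ∀ t v → 1ℤ * (t - v) + v ≡ t
      cancel = solve-∀

  ∑-inv : ∀ {G : ℤ → ℤ} → G Preserves _≈_ ⟶ _≡_ →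
          ∑[ s < p ] G (inv (+ s)) ≡ ∑[ t < p ] G (+ t)
  ∑-inv G-cong = ∑-permute G-cong (inv ∘ +_) injective surjective
    where
    injective : ∀ {s s'} → s ℕ.< p → s' ℕ.< p → inv (+ s) ≈ inv (+ s') → s ≡ s'
    injective {s} {s'} s<p s'<p inv-s≈inv-s' = ≈⇒≡ s<p s'<p (begin
      + s              ≈⟨ inv-involutive (+ s) ⟨
      inv (inv (+ s))  ≈⟨ inv-cong inv-s≈inv-s' ⟩
      inv (inv (+ s')) ≈⟨ inv-involutive (+ s') ⟩
      + s'             ∎)
      where open ≈-Reasoning
    surjective : ∀ {t} → t ℕ.< p → ∃ λ s → s ℕ.< p × inv (+ s) ≈ + t
    surjective {t} _ = rep (inv (+ t)) , rep<p (inv (+ t)) ,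
                       ≈-trans (inv-cong (≈-sym (≈rep (inv (+ t))))) (inv-involutive (+ t))

  -≉0 : ∀ {x} → x ≉ 0ℤ → - x ≉ 0ℤ
  -≉0 {x} x≉0 -x≈0 = x≉0 (≈-trans (≈-reflexive (sym (ℤP.neg-involutive x))) (-‿cong -x≈0))

  square-roots : ∀ {s r} → s * s ≈ r * r → s ≈ r ⊎ s ≈ - r
  square-roots {s} {r} s²≈r² =
    Sum.map (congruent ∘ ≈0⇒∣)
            (λ s+r≈0 → congruent (subst (+ p ∣_) (sum-as-difference s r) (≈0⇒∣ s+r≈0)))
            (≈0-* (∣⇒≈0 (subst (+ p ∣_) (difference-of-squares s r) (p∣x-y s²≈r²))))
    where
    difference-of-squares : ∀ s r → s * s - r * r ≡ (s - r) * (s + r)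
    difference-of-squares = solve-∀
    sum-as-difference : ∀ s r → s + r ≡ s - - r
    sum-as-difference = solve-∀

  square-root-≉0 : ∀ {w x} → x ≉ 0ℤ → w * w ≈ x → w ≉ 0ℤ
  square-root-≉0 {w} x≉0 w²≈x w≈0 = x≉0 (≈-trans (≈-sym w²≈x) (*-≈0ˡ w w≈0))

  IsSquare-÷ : ∀ {n t} → t ≉ 0ℤ → IsSquare t → IsSquare (n * t) → IsSquare n
  IsSquare-÷ {n} {t} t≉0 (a , a²≈t) (v , v²≈nt) = v * inv a , (begin
    v * inv a * (v * inv a)            ≡⟨ regroup v (inv a) ⟩
    v * v * (inv a * inv a)            ≈⟨ *-congʳ (inv a * inv a) v²≈nt ⟩
    n * t * (inv a * inv a)            ≈⟨ *-congʳ (inv a * inv a) (*-congˡ n a²≈t) ⟨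
    n * (a * a) * (inv a * inv a)      ≡⟨ regroup′ n a (inv a) ⟩
    n * (inv a * a * (inv a * a))      ≈⟨ *-congˡ n (*-cong ia≈1 ia≈1) ⟩
    n * (1ℤ * 1ℤ)                      ≡⟨ ℤP.*-identityʳ n ⟩
    n                                  ∎)
    where
    open ≈-Reasoning
    ia≈1 : inv a * a ≈ 1ℤ
    ia≈1 = inv-inverse (square-root-≉0 t≉0 a²≈t)
    regroup : ∀ v i → v * i * (v * i) ≡ v * v * (i * i)
    regroup = solve-∀
    regroup′ : ∀ n a i → n * (a * a) * (i * i) ≡ n * (i * a * (i * a))
    regroup′ = solve-∀

  -- Character sums for odd p

  module _ (2≉0 : + 2 ≉ 0ℤ) where

    ≈-neg⇒≈0 : ∀ {x} → x ≈ - x → x ≈ 0ℤ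
    ≈-neg⇒≈0 {x} x≈-x = *-cancelˡ-≈0 2≉0 (∣⇒≈0 (subst (+ p ∣_) (double x) (p∣x-y x≈-x)))
      where
      double : ∀ x → x - - x ≡ + 2 * x
      double = solve-∀

    roots : ℤ → ℤ
    roots t = ∑[ s < p ] 𝟙[ + s * + s ≈ t ]

    roots≡1+χ : ∀ t → roots t ≡ 1ℤ + χ t
    roots≡1+χ t with χ t | legendreView t
    ... | _ | vanishing t≈0 = trans (∑-single p 0<p off) (𝟙-≈ (≈-sym t≈0))
      where
      off : ∀ s → s ℕ.< p → s ≢ 0 → 𝟙[ + s * + s ≈ t ] ≡ 0ℤ
      off s s<p s≢0 = 𝟙-≉ λ s²≈t → s≢0 (≈⇒≡ s<p 0<p (square≈0 (≈-trans s²≈t t≈0)))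
    ... | _ | residue t≉0 (y , y²≈t) =
      trans (∑-pair p (rep<p y) (rep<p (- y)) r≢r′ off) (cong₂ _+_ (𝟙-≈ r²≈t) (𝟙-≈ r′²≈t))
      where
      neg-square : ∀ y → - y * - y ≡ y * y
      neg-square = solve-∀
      r≈y : + rep y ≈ y
      r≈y = ≈-sym (≈rep y)
      r′≈-y : + rep (- y) ≈ - y
      r′≈-y = ≈-sym (≈rep (- y))
      r²≈t : + rep y * + rep y ≈ t
      r²≈t = ≈-trans (*-cong r≈y r≈y) y²≈t
      r′²≈t : + rep (- y) * + rep (- y) ≈ t
      r′²≈t = ≈-trans (*-cong r′≈-y r′≈-y) (≈-trans (≈-reflexive (neg-square y)) y²≈t)
      r≢r′ : rep y ≢ rep (- y)
      r≢r′ r≡r′ = square-root-≉0 t≉0 y²≈t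
        (≈-neg⇒≈0 (≈-trans (≈-sym r≈y) (≈-trans (≈-reflexive (cong +_ r≡r′)) r′≈-y)))
      off : ∀ s → s ℕ.< p → s ≢ rep y → s ≢ rep (- y) → 𝟙[ + s * + s ≈ t ] ≡ 0ℤ
      off s s<p s≢r s≢r′ = 𝟙-≉ λ s²≈t →
        [ (λ s≈y → s≢r (≈⇒≡ s<p (rep<p y) (≈-trans s≈y (≈-sym r≈y))))
        , (λ s≈-y → s≢r′ (≈⇒≡ s<p (rep<p (- y)) (≈-trans s≈-y (≈-sym r′≈-y))))
        ]′ (square-roots (≈-trans s²≈t (≈-sym y²≈t)))
    ... | _ | nonresidue _ ¬□t = ∑-zero p λ s _ → 𝟙-≉ λ s²≈t → ¬□t (+ s , s²≈t)

    ∑-squares : ∀ {G : ℤ → ℤ} → G Preserves _≈_ ⟶ _≡_ →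
                ∑[ s < p ] G (+ s * + s) ≡ ∑[ t < p ] G (+ t) + ∑[ t < p ] (G (+ t) * χ (+ t))
    ∑-squares {G} G-cong = begin
      ∑[ s < p ] G (+ s * + s)
        ≡⟨ ∑-fibres G-cong (λ s → + s * + s) ⟩
      ∑[ t < p ] (G (+ t) * roots (+ t))
        ≡⟨ ∑-cong p (λ t _ → cong (G (+ t) *_) (roots≡1+χ (+ t))) ⟩
      ∑[ t < p ] (G (+ t) * (1ℤ + χ (+ t)))
        ≡⟨ ∑-cong p (λ t _ → distrib (G (+ t)) (χ (+ t))) ⟩
      ∑[ t < p ] (G (+ t) + G (+ t) * χ (+ t))
        ≡⟨ ∑-+ p _ _ ⟩
      ∑[ t < p ] G (+ t) + ∑[ t < p ] (G (+ t) * χ (+ t)) ∎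
      where
      open ≡-Reasoning
      distrib : ∀ g c → g * (1ℤ + c) ≡ g + g * c
      distrib = solve-∀

    ∑χ≡0 : ∑[ t < p ] χ (+ t) ≡ 0ℤ
    ∑χ≡0 = cancel (∑[ _ < p ] 1ℤ) _ (trans (∑-squares {λ _ → 1ℤ} (λ _ → refl))
      (cong (_+_ (∑[ _ < p ] 1ℤ)) (∑-cong p λ t _ → ℤP.*-identityˡ (χ (+ t)))))
      where
      cancel : ∀ a b → a ≡ a + b → b ≡ 0ℤ
      cancel a b a≡a+b = trans (regroup a b) (trans (cong (_- a) (sym a≡a+b)) (ℤP.+-inverseʳ a))
        where
        regroup : ∀ a b → b ≡ a + b - a
        regroup = solve-∀

    ∑χ-affine : ∀ {u} v → u ≉ 0ℤ → ∑[ t < p ] χ (u * + t + v) ≡ 0ℤ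
    ∑χ-affine v u≉0 = trans (∑-affine χ-cong v u≉0) ∑χ≡0

    -- Multiplying by a nonresidue n maps residues to nonresidues; since the values of χ
    -- sum to 0 over both t and n t, it must also map nonresidues to residues.
    χ-*-nonresidue : ∀ {n} → n ≉ 0ℤ → ¬ IsSquare n → ∀ y → χ (n * y) ≡ - χ y
    χ-*-nonresidue {n} n≉0 ¬□n y = begin
      χ (n * y)        ≡⟨ χ-cong (*-congˡ n (≈rep y)) ⟩
      χ (n * + rep y)  ≡⟨ +≡0⇒≡- (∑-nonpos-≡0 p pair≤0 ∑pair≡0 (rep y) (rep<p y)) ⟩
      - χ (+ rep y)    ≡⟨ cong -_ (χ-cong (≈rep y)) ⟨
      - χ y            ∎
      where
      open ≡-Reasoning
      pair≤0 : ∀ t → t ℕ.< p → χ (n * + t) + χ (+ t) ≤ 0ℤ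
      pair≤0 t _ with χ (+ t) | legendreView (+ t)
      ... | _ | vanishing t≈0   = ℤP.≤-reflexive (cong (_+ 0ℤ) (χ-vanishing (*-≈0ʳ n t≈0)))
      ... | _ | residue t≉0 □t  =
        ℤP.≤-reflexive (cong (_+ 1ℤ) (χ-nonresidue (*-≉0 n≉0 t≉0) (¬□n ∘ IsSquare-÷ t≉0 □t)))
      ... | _ | nonresidue _ _  = ℤP.+-monoˡ-≤ -1ℤ (χ≤1 (n * + t))
      ∑pair≡0 : ∑[ t < p ] (χ (n * + t) + χ (+ t)) ≡ 0ℤ
      ∑pair≡0 = trans (∑-+ p _ _) (cong₂ _+_
        (trans (∑-cong p λ t _ → cong χ (sym (ℤP.+-identityʳ (n * + t)))) (∑χ-affine 0ℤ n≉0))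
        ∑χ≡0)
      +≡0⇒≡- : ∀ {a b} → a + b ≡ 0ℤ → a ≡ - b
      +≡0⇒≡- {a} {b} a+b≡0 = trans (regroup a b) (trans (cong (_- b) a+b≡0) (ℤP.+-identityˡ (- b)))
        where
        regroup : ∀ a b → a ≡ a + b - b
        regroup = solve-∀

    χ-* : ∀ x y → χ (x * y) ≡ χ x * χ y
    χ-* x y with χ x | legendreView x
    ... | _ | vanishing x≈0 = χ-vanishing (*-≈0ˡ y x≈0)
    ... | _ | residue x≉0 (w , w²≈x) = begin
      χ (x * y)      ≡⟨ χ-cong (*-congʳ y w²≈x) ⟨
      χ (w * w * y)  ≡⟨ χ-*-square w y (square-root-≉0 x≉0 w²≈x) ⟩
      χ y            ≡⟨ ℤP.*-identityˡ (χ y) ⟨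
      1ℤ * χ y       ∎
      where open ≡-Reasoning
    ... | _ | nonresidue x≉0 ¬□x = trans (χ-*-nonresidue x≉0 ¬□x y) (sym (ℤP.-1*i≡-i (χ y)))

    χ-square : ∀ x → χ (x * x) ≡ 1ℤ - 𝟙[ x ≈ 0ℤ ]
    χ-square x with x ≈? 0ℤ
    ... | yes x≈0 = trans (χ-vanishing (*-≈0ˡ x x≈0)) (sym (cong (_-_ 1ℤ) (𝟙-≈ x≈0)))
    ... | no x≉0  = trans (χ-residue (*-≉0 x≉0 x≉0) (x , ≈-refl)) (sym (cong (_-_ 1ℤ) (𝟙-≉ x≉0)))

    -- For t ≢ 0 one has t (t + k) = t² (k t⁻¹ + 1), and t ↦ t⁻¹ is a bijection of ℤ/p.
    ∑χ-t[t+k] : ∀ {k} → k ≉ 0ℤ → ∑[ t < p ] χ (+ t * (+ t + k)) ≡ -1ℤ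
    ∑χ-t[t+k] {k} k≉0 = begin
      ∑[ t < p ] χ (+ t * (+ t + k))
        ≡⟨ ∑-cong p (λ t _ → pointwise (+ t)) ⟩
      ∑[ t < p ] (χ (k * inv (+ t) + 1ℤ) - 𝟙[ + t ≈ 0ℤ ])
        ≡⟨ ∑-- p _ _ ⟩
      ∑[ t < p ] χ (k * inv (+ t) + 1ℤ) - ∑[ t < p ] 𝟙[ + t ≈ 0ℤ ]
        ≡⟨ cong₂ _-_ ∑χ[k/t+1]≡0 ∑-𝟙≈0 ⟩
      0ℤ - 1ℤ ∎
      where
      open ≡-Reasoning
      ∑χ[k/t+1]≡0 : ∑[ t < p ] χ (k * inv (+ t) + 1ℤ) ≡ 0ℤ
      ∑χ[k/t+1]≡0 =
        trans (∑-inv λ x≈y → χ-cong (+-congʳ 1ℤ (*-congˡ k x≈y))) (∑χ-affine 1ℤ k≉0)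
      pointwise : ∀ t → χ (t * (t + k)) ≡ χ (k * inv t + 1ℤ) - 𝟙[ t ≈ 0ℤ ]
      pointwise t = by-cases (t ≈? 0ℤ)
        where
        by-cases : Dec (t ≈ 0ℤ) → χ (t * (t + k)) ≡ χ (k * inv t + 1ℤ) - 𝟙[ t ≈ 0ℤ ]
        by-cases (yes t≈0) = begin
          χ (t * (t + k))
            ≡⟨ χ-vanishing (*-≈0ˡ (t + k) t≈0) ⟩
          0ℤ
            ≡⟨ cong (_- 1ℤ) χ-1 ⟨
          χ 1ℤ - 1ℤ
            ≡⟨ cong₂ _-_ (cong χ k/t+1≡1) (𝟙-≈ t≈0) ⟨
          χ (k * inv t + 1ℤ) - 𝟙[ t ≈ 0ℤ ] ∎
          where
          k/t+1≡1 : k * inv t + 1ℤ ≡ 1ℤ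
          k/t+1≡1 = trans (cong (λ i → k * i + 1ℤ) (inv-≈0 t≈0)) (cong (_+ 1ℤ) (ℤP.*-zeroʳ k))
        by-cases (no t≉0) = begin
          χ (t * (t + k))                      ≡⟨ χ-cong factored ⟩
          χ (t * t * (k * inv t + 1ℤ))         ≡⟨ χ-*-square t _ t≉0 ⟩
          χ (k * inv t + 1ℤ)                   ≡⟨ ℤP.+-identityʳ _ ⟨
          χ (k * inv t + 1ℤ) - 0ℤ              ≡⟨ cong (_-_ (χ (k * inv t + 1ℤ))) (𝟙-≉ t≉0) ⟨
          χ (k * inv t + 1ℤ) - 𝟙[ t ≈ 0ℤ ]     ∎
          where
          expand : ∀ t k i → t * t * (k * i + 1ℤ) ≡ k * t * (i * t) + t * t
          expand = solve-∀
          collect : ∀ t k → k * t * 1ℤ + t * t ≡ t * (t + k)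
          collect = solve-∀
          factored : t * (t + k) ≈ t * t * (k * inv t + 1ℤ)
          factored = ≈-sym (≈-trans (≈-reflexive (expand t k (inv t)))
                       (≈-trans (+-congʳ (t * t) (*-congˡ (k * t) (inv-inverse t≉0)))
                                (≈-reflexive (collect t k))))

    ∑χ-s²-δ : ∀ {δ} → δ ≉ 0ℤ → ∑[ s < p ] χ (+ s * + s - δ) ≡ -1ℤ
    ∑χ-s²-δ {δ} δ≉0 = begin
      ∑[ s < p ] χ (+ s * + s - δ)
        ≡⟨ ∑-squares (λ x≈y → χ-cong (+-congʳ (- δ) x≈y)) ⟩
      ∑[ t < p ] χ (+ t - δ) + ∑[ t < p ] (χ (+ t - δ) * χ (+ t))
        ≡⟨ cong₂ _+_ shifted products ⟩
      0ℤ + -1ℤ ∎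
      where
      open ≡-Reasoning
      shifted : ∑[ t < p ] χ (+ t - δ) ≡ 0ℤ
      shifted = trans (∑-cong p λ t _ → cong (λ z → χ (z - δ)) (sym (ℤP.*-identityˡ (+ t))))
                      (∑χ-affine (- δ) 1≉0)
      products : ∑[ t < p ] (χ (+ t - δ) * χ (+ t)) ≡ -1ℤ
      products = trans (∑-cong p λ t _ → trans (ℤP.*-comm (χ (+ t - δ)) (χ (+ t)))
                                               (sym (χ-* (+ t) (+ t - δ))))
                       (∑χ-t[t+k] (-≉0 δ≉0))

    complete-square : ∀ A B C t →
      + 2 * + 2 * (A * (A * t * t + B * t + C)) ≡
      (+ 2 * A * t + B) * (+ 2 * A * t + B) - (B * B - + 4 * A * C)
    complete-square = solve-∀

    ∑χ-quadratic : ∀ {A B C} → A ≉ 0ℤ → B * B - + 4 * A * C ≉ 0ℤ →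
                   ∑[ t < p ] χ (A * + t * + t + B * + t + C) ≡ - χ A
    ∑χ-quadratic {A} {B} {C} A≉0 disc≉0 = cancel-unit (χ²≡1 A≉0) (begin
      χ A * ∑[ t < p ] χ (A * + t * + t + B * + t + C)
        ≡⟨ ∑-*ˡ p (χ A) _ ⟨
      ∑[ t < p ] (χ A * χ (A * + t * + t + B * + t + C))
        ≡⟨ ∑-cong p (λ t _ → completed (+ t)) ⟩
      ∑[ t < p ] χ ((+ 2 * A * + t + B) * (+ 2 * A * + t + B) - disc)
        ≡⟨ ∑-affine G-cong B (*-≉0 2≉0 A≉0) ⟩
      ∑[ s < p ] χ (+ s * + s - disc)
        ≡⟨ ∑χ-s²-δ disc≉0 ⟩
      -1ℤ ∎)
      where
      open ≡-Reasoning
      disc : ℤ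
      disc = B * B - + 4 * A * C
      G-cong : (λ x → χ (x * x - disc)) Preserves _≈_ ⟶ _≡_
      G-cong x≈y = χ-cong (+-congʳ (- disc) (*-cong x≈y x≈y))
      completed : ∀ t → χ A * χ (A * t * t + B * t + C) ≡ χ ((+ 2 * A * t + B) * (+ 2 * A * t + B) - disc)
      completed t = begin
        χ A * χ (A * t * t + B * t + C)                 ≡⟨ χ-* A _ ⟨
        χ (A * (A * t * t + B * t + C))                 ≡⟨ χ-*-square (+ 2) _ 2≉0 ⟨
        χ (+ 2 * + 2 * (A * (A * t * t + B * t + C)))   ≡⟨ cong χ (complete-square A B C t) ⟩
        χ ((+ 2 * A * t + B) * (+ 2 * A * t + B) - disc) ∎
      cancel-unit : ∀ {a s} → a * a ≡ 1ℤ → a * s ≡ -1ℤ → s ≡ - a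
      cancel-unit {a} {s} a²≡1 as≡-1 = begin
        s              ≡⟨ ℤP.*-identityˡ s ⟨
        1ℤ * s         ≡⟨ cong (_* s) a²≡1 ⟨
        a * a * s      ≡⟨ ℤP.*-assoc a a s ⟩
        a * (a * s)    ≡⟨ cong (a *_) as≡-1 ⟩
        a * -1ℤ        ≡⟨ ℤP.*-comm a -1ℤ ⟩
        -1ℤ * a        ≡⟨ ℤP.-1*i≡-i a ⟩
        - a            ∎

    roots-quadratic : ∀ {A B C} → A ≉ 0ℤ →
                      ∑[ t < p ] 𝟙[ A * + t * + t + B * + t + C ≈ 0ℤ ] ≡ 1ℤ + χ (B * B - + 4 * A * C)
    roots-quadratic {A} {B} {C} A≉0 = begin
      ∑[ t < p ] 𝟙[ A * + t * + t + B * + t + C ≈ 0ℤ ]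
        ≡⟨ ∑-cong p (λ t _ → 𝟙-cong (to (+ t)) (from (+ t))) ⟩
      ∑[ t < p ] 𝟙[ (+ 2 * A * + t + B) * (+ 2 * A * + t + B) ≈ disc ]
        ≡⟨ ∑-affine G-cong B (*-≉0 2≉0 A≉0) ⟩
      roots disc
        ≡⟨ roots≡1+χ disc ⟩
      1ℤ + χ disc ∎
      where
      open ≡-Reasoning
      disc : ℤ
      disc = B * B - + 4 * A * C
      G-cong : (λ x → 𝟙[ x * x ≈ disc ]) Preserves _≈_ ⟶ _≡_
      G-cong x≈y = 𝟙-resp (*-cong x≈y x≈y) (≈-refl {disc})
      to : ∀ t → A * t * t + B * t + C ≈ 0ℤ → (+ 2 * A * t + B) * (+ 2 * A * t + B) ≈ disc
      to t q≈0 = congruent (subst (+ p ∣_) (complete-square A B C t)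
                                  (≈0⇒∣ (*-≈0ʳ (+ 2 * + 2) (*-≈0ʳ A q≈0))))
      from : ∀ t → (+ 2 * A * t + B) * (+ 2 * A * t + B) ≈ disc → A * t * t + B * t + C ≈ 0ℤ
      from t completed≈disc = *-cancelˡ-≈0 A≉0 (*-cancelˡ-≈0 (*-≉0 2≉0 2≉0)
        (∣⇒≈0 (subst (+ p ∣_) (sym (complete-square A B C t)) (p∣x-y completed≈disc))))

    ∑χ-t[At+B] : ∀ {A} B → A ≉ 0ℤ →
                 ∑[ t < p ] χ (+ t * (A * + t + B)) ≡ - χ A + + p * (𝟙[ B ≈ 0ℤ ] * χ A)
    ∑χ-t[At+B] {A} B A≉0 with B ≈? 0ℤ
    ... | yes B≈0 = begin
      ∑[ t < p ] χ (+ t * (A * + t + B))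
        ≡⟨ ∑-cong p (λ t _ → pointwise (+ t)) ⟩
      ∑[ t < p ] (χ A * (1ℤ - 𝟙[ + t ≈ 0ℤ ]))
        ≡⟨ ∑-*ˡ p (χ A) _ ⟩
      χ A * ∑[ t < p ] (1ℤ - 𝟙[ + t ≈ 0ℤ ])
        ≡⟨ cong (χ A *_) (trans (∑-- p _ _) (cong₂ _-_ (∑-const p 1ℤ) ∑-𝟙≈0)) ⟩
      χ A * (+ p * 1ℤ - 1ℤ)
        ≡⟨ regroup (χ A) (+ p) ⟩
      - χ A + + p * (1ℤ * χ A)
        ≡⟨ cong (λ i → - χ A + + p * (i * χ A)) (𝟙-≈ B≈0) ⟨
      - χ A + + p * (𝟙[ B ≈ 0ℤ ] * χ A) ∎
      where
      open ≡-Reasoning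
      regroup : ∀ a P → a * (P * 1ℤ - 1ℤ) ≡ - a + P * (1ℤ * a)
      regroup = solve-∀
      drop-B : ∀ t A → t * (A * t + 0ℤ) ≡ A * (t * t)
      drop-B = solve-∀
      pointwise : ∀ t → χ (t * (A * t + B)) ≡ χ A * (1ℤ - 𝟙[ t ≈ 0ℤ ])
      pointwise t = begin
        χ (t * (A * t + B))        ≡⟨ χ-cong (*-congˡ t (+-congˡ (A * t) B≈0)) ⟩
        χ (t * (A * t + 0ℤ))       ≡⟨ cong χ (drop-B t A) ⟩
        χ (A * (t * t))            ≡⟨ χ-* A (t * t) ⟩
        χ A * χ (t * t)            ≡⟨ cong (χ A *_) (χ-square t) ⟩
        χ A * (1ℤ - 𝟙[ t ≈ 0ℤ ])   ∎
    ... | no B≉0 = begin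
      ∑[ t < p ] χ (+ t * (A * + t + B))            ≡⟨ ∑-cong p (λ t _ → cong χ (expand (+ t) A B)) ⟩
      ∑[ t < p ] χ (A * + t * + t + B * + t + 0ℤ)   ≡⟨ ∑χ-quadratic {A} {B} {0ℤ} A≉0 disc≉0 ⟩
      - χ A                                         ≡⟨ ℤP.+-identityʳ (- χ A) ⟨
      - χ A + 0ℤ                                    ≡⟨ cong (_+_ (- χ A)) (ℤP.*-zeroʳ (+ p)) ⟨
      - χ A + + p * (0ℤ * χ A)                      ≡⟨ cong (λ i → - χ A + + p * (i * χ A)) (𝟙-≉ B≉0) ⟨
      - χ A + + p * (𝟙[ B ≈ 0ℤ ] * χ A)             ∎
      where
      open ≡-Reasoning
      expand : ∀ t A B → t * (A * t + B) ≡ A * t * t + B * t + 0ℤ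
      expand = solve-∀
      disc : ∀ A B → B * B - + 4 * A * 0ℤ ≡ B * B
      disc = solve-∀
      disc≉0 : B * B - + 4 * A * 0ℤ ≉ 0ℤ
      disc≉0 = subst (_≉ 0ℤ) (sym (disc A B)) (*-≉0 B≉0 B≉0)

    ∑χ-Ay²+B : ∀ A B → ∑[ y < p ] χ (A * (+ y * + y) + B) ≡
                       - χ A + + p * (𝟙[ B ≈ 0ℤ ] * χ A + 𝟙[ A ≈ 0ℤ ] * χ B)
    ∑χ-Ay²+B A B with A ≈? 0ℤ
    ... | yes A≈0 = begin
      ∑[ y < p ] χ (A * (+ y * + y) + B)    ≡⟨ ∑-cong p (λ y _ → χ-cong (drop-A (+ y))) ⟩
      ∑[ _ < p ] χ B                        ≡⟨ ∑-const p (χ B) ⟩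
      + p * χ B                             ≡⟨ regroup (+ p) (𝟙[ B ≈ 0ℤ ]) (χ B) ⟩
      - 0ℤ + + p * (𝟙[ B ≈ 0ℤ ] * 0ℤ + 1ℤ * χ B)
        ≡⟨ cong₂ (λ a i → - a + + p * (𝟙[ B ≈ 0ℤ ] * a + i * χ B)) (χ-vanishing A≈0) (𝟙-≈ A≈0) ⟨
      - χ A + + p * (𝟙[ B ≈ 0ℤ ] * χ A + 𝟙[ A ≈ 0ℤ ] * χ B) ∎
      where
      open ≡-Reasoning
      drop-A : ∀ y → A * (y * y) + B ≈ B
      drop-A y = ≈-trans (+-congʳ B (*-≈0ˡ (y * y) A≈0)) (≈-reflexive (ℤP.+-identityˡ B))
      regroup : ∀ P b c → P * c ≡ - 0ℤ + P * (b * 0ℤ + 1ℤ * c)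
      regroup = solve-∀
    ... | no A≉0 = begin
      ∑[ y < p ] χ (A * (+ y * + y) + B)
        ≡⟨ ∑-squares (λ x≈y → χ-cong (+-congʳ B (*-congˡ A x≈y))) ⟩
      ∑[ t < p ] χ (A * + t + B) + ∑[ t < p ] (χ (A * + t + B) * χ (+ t))
        ≡⟨ cong₂ _+_ (∑χ-affine B A≉0) (trans (∑-cong p λ t _ → product (+ t)) (∑χ-t[At+B] B A≉0)) ⟩
      0ℤ + (- χ A + + p * (𝟙[ B ≈ 0ℤ ] * χ A))
        ≡⟨ ℤP.+-identityˡ _ ⟩
      - χ A + + p * (𝟙[ B ≈ 0ℤ ] * χ A)
        ≡⟨ cong (λ e → - χ A + + p * e) (ℤP.+-identityʳ (𝟙[ B ≈ 0ℤ ] * χ A)) ⟨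
      - χ A + + p * (𝟙[ B ≈ 0ℤ ] * χ A + 0ℤ * χ B)
        ≡⟨ cong (λ i → - χ A + + p * (𝟙[ B ≈ 0ℤ ] * χ A + i * χ B)) (𝟙-≉ A≉0) ⟨
      - χ A + + p * (𝟙[ B ≈ 0ℤ ] * χ A + 𝟙[ A ≈ 0ℤ ] * χ B) ∎
      where
      open ≡-Reasoning
      product : ∀ t → χ (A * t + B) * χ t ≡ χ (t * (A * t + B))
      product t = trans (ℤP.*-comm (χ (A * t + B)) (χ t)) (sym (χ-* t (A * t + B)))

    -- The surface f = 0

    module Surface (a b c d : ℤ) (a≉0 : a ≉ 0ℤ) (b≉0 : b ≉ 0ℤ) (c≉0 : c ≉ 0ℤ) (d≉0 : d ≉ 0ℤ)
                   (D≉0 : d * d - + 4 * a * b * c ≉ 0ℤ) where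

      D : ℤ
      D = d * d - + 4 * a * b * c

      Δ : ℤ → ℤ
      Δ z = d * d * (z * z) - + 4 * a * b

      M : ℤ → ℤ
      M z = + 4 * a * (1ℤ - c * (z * z))

      ∑ₓ : ∀ y z → ∑[ x < p ] 𝟙 (divides? p (f a b c d (+ x) y z)) ≡ 1ℤ + χ (Δ z * (y * y) + M z)
      ∑ₓ y z = begin
        ∑[ x < p ] 𝟙 (divides? p (f a b c d (+ x) y z))
          ≡⟨ ∑-cong p (λ x _ → trans (𝟙-divides? (f a b c d (+ x) y z))
                                     (cong (λ e → 𝟙[ e ≈ 0ℤ ]) (as-quadratic (+ x)))) ⟩
        ∑[ x < p ] 𝟙[ a * + x * + x + B * + x + C ≈ 0ℤ ]
          ≡⟨ roots-quadratic {a} {B} {C} a≉0 ⟩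
        1ℤ + χ (B * B - + 4 * a * C)
          ≡⟨ cong (λ e → 1ℤ + χ e) (discriminant a b c d y z) ⟩
        1ℤ + χ (Δ z * (y * y) + M z) ∎
        where
        open ≡-Reasoning
        B C : ℤ
        B = - (d * y * z)
        C = b * y * y + c * z * z - 1ℤ
        as-quadratic : ∀ x → f a b c d x y z ≡ a * x * x + B * x + C
        as-quadratic x = rearrange a b c d x y z
          where
          rearrange : ∀ a b c d x y z →
            a * x * x + b * y * y + c * z * z - d * x * y * z - + 1 ≡
            a * x * x + - (d * y * z) * x + (b * y * y + c * z * z - 1ℤ)
          rearrange = solve-∀
        discriminant : ∀ a b c d y z →
          - (d * y * z) * - (d * y * z) - + 4 * a * (b * y * y + c * z * z - 1ℤ) ≡
          (d * d * (z * z) - + 4 * a * b) * (y * y) + + 4 * a * (1ℤ - c * (z * z))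
        discriminant = solve-∀

      Γ : ℤ → ℤ
      Γ z = 𝟙[ M z ≈ 0ℤ ] * χ (Δ z) + 𝟙[ Δ z ≈ 0ℤ ] * χ (M z)

      ∑ₓᵧ : ∀ z → ∑[ y < p ] ∑[ x < p ] 𝟙 (divides? p (f a b c d (+ x) (+ y) z)) ≡ + p - χ (Δ z) + + p * Γ z
      ∑ₓᵧ z = begin
        ∑[ y < p ] ∑[ x < p ] 𝟙 (divides? p (f a b c d (+ x) (+ y) z))
          ≡⟨ ∑-cong p (λ y _ → ∑ₓ (+ y) z) ⟩
        ∑[ y < p ] (1ℤ + χ (Δ z * (+ y * + y) + M z))
          ≡⟨ ∑-+ p _ _ ⟩
        ∑[ _ < p ] 1ℤ + ∑[ y < p ] χ (Δ z * (+ y * + y) + M z)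
          ≡⟨ cong₂ _+_ (trans (∑-const p 1ℤ) (ℤP.*-identityʳ (+ p))) (∑χ-Ay²+B (Δ z) (M z)) ⟩
        + p + (- χ (Δ z) + + p * Γ z)
          ≡⟨ ℤP.+-assoc (+ p) (- χ (Δ z)) (+ p * Γ z) ⟨
        + p - χ (Δ z) + + p * Γ z ∎
        where open ≡-Reasoning

      ∑χΔ : ∑[ z < p ] χ (Δ (+ z)) ≡ -1ℤ
      ∑χΔ = begin
        ∑[ z < p ] χ (Δ (+ z))
          ≡⟨ ∑-cong p (λ z _ → cong χ (as-quadratic a b d (+ z))) ⟩
        ∑[ z < p ] χ (d * d * + z * + z + 0ℤ * + z + - (+ 4 * a * b))
          ≡⟨ ∑χ-quadratic {d * d} {0ℤ} { - (+ 4 * a * b)} (*-≉0 d≉0 d≉0) disc≉0 ⟩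
        - χ (d * d)
          ≡⟨ cong -_ (trans (χ-* d d) (χ²≡1 d≉0)) ⟩
        -1ℤ ∎
        where
        open ≡-Reasoning
        as-quadratic : ∀ a b d z →
                       d * d * (z * z) - + 4 * a * b ≡ d * d * z * z + 0ℤ * z + - (+ 4 * a * b)
        as-quadratic = solve-∀
        disc : ∀ a b d →
               0ℤ * 0ℤ - + 4 * (d * d) * - (+ 4 * a * b) ≡ + 2 * + 2 * (+ 2 * + 2 * (a * b * (d * d)))
        disc = solve-∀
        disc≉0 : 0ℤ * 0ℤ - + 4 * (d * d) * - (+ 4 * a * b) ≉ 0ℤ
        disc≉0 = subst (_≉ 0ℤ) (sym (disc a b d))
          (*-≉0 (*-≉0 2≉0 2≉0) (*-≉0 (*-≉0 2≉0 2≉0) (*-≉0 (*-≉0 a≉0 b≉0) (*-≉0 d≉0 d≉0))))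

      M≈0⇒cz²≈1 : ∀ z → M z ≈ 0ℤ → c * (z * z) ≈ 1ℤ
      M≈0⇒cz²≈1 z M≈0 =
        ≈-sym (congruent (≈0⇒∣ (*-cancelˡ-≈0 (*-≉0 (*-≉0 2≉0 2≉0) a≉0) M≈0)))

      cz²≈1⇒M≈0 : ∀ z → c * (z * z) ≈ 1ℤ → M z ≈ 0ℤ
      cz²≈1⇒M≈0 z cz²≈1 =
        ≈-trans (*-congˡ (+ 4 * a) (+-congˡ 1ℤ (-‿cong cz²≈1))) (≈-reflexive (ℤP.*-zeroʳ (+ 4 * a)))

      ∑𝟙[M≈0] : ∑[ z < p ] 𝟙[ M (+ z) ≈ 0ℤ ] ≡ 1ℤ + χ c
      ∑𝟙[M≈0] = begin
        ∑[ z < p ] 𝟙[ M (+ z) ≈ 0ℤ ]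
          ≡⟨ ∑-cong p (λ z _ → 𝟙-cong (to (+ z)) (from (+ z))) ⟩
        ∑[ z < p ] 𝟙[ (c * + z + 0ℤ) * (c * + z + 0ℤ) ≈ c ]
          ≡⟨ ∑-affine (λ x≈y → 𝟙-resp (*-cong x≈y x≈y) (≈-refl {c})) 0ℤ c≉0 ⟩
        roots c
          ≡⟨ roots≡1+χ c ⟩
        1ℤ + χ c ∎
        where
        open ≡-Reasoning
        scale : ∀ c z → (c * z + 0ℤ) * (c * z + 0ℤ) ≡ c * (c * (z * z))
        scale = solve-∀
        to : ∀ z → M z ≈ 0ℤ → (c * z + 0ℤ) * (c * z + 0ℤ) ≈ c
        to z M≈0 = ≈-trans (≈-reflexive (scale c z))
                       (≈-trans (*-congˡ c (M≈0⇒cz²≈1 z M≈0)) (≈-reflexive (ℤP.*-identityʳ c)))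
        from : ∀ z → (c * z + 0ℤ) * (c * z + 0ℤ) ≈ c → M z ≈ 0ℤ
        from z c²z²≈c = cz²≈1⇒M≈0 z (*-cancelˡ c≉0
          (≈-trans (≈-reflexive (sym (scale c z)))
                   (≈-trans c²z²≈c (≈-reflexive (sym (ℤP.*-identityʳ c))))))

      ∑𝟙[M≈0]χΔ : ∑[ z < p ] (𝟙[ M (+ z) ≈ 0ℤ ] * χ (Δ (+ z))) ≡ χ D * (χ c + 1ℤ)
      ∑𝟙[M≈0]χΔ = begin
        ∑[ z < p ] (𝟙[ M (+ z) ≈ 0ℤ ] * χ (Δ (+ z)))
          ≡⟨ ∑-cong p (λ z _ → 𝟙-*ˡ _ (χ (c * D)) (on-conic (+ z))) ⟩
        ∑[ z < p ] (χ (c * D) * 𝟙[ M (+ z) ≈ 0ℤ ])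
          ≡⟨ ∑-*ˡ p (χ (c * D)) _ ⟩
        χ (c * D) * ∑[ z < p ] 𝟙[ M (+ z) ≈ 0ℤ ]
          ≡⟨ cong₂ _*_ (χ-* c D) ∑𝟙[M≈0] ⟩
        χ c * χ D * (1ℤ + χ c)
          ≡⟨ regroup (χ c) (χ D) ⟩
        χ D * (χ c + χ c * χ c)
          ≡⟨ cong (λ s → χ D * (χ c + s)) (χ²≡1 c≉0) ⟩
        χ D * (χ c + 1ℤ) ∎
        where
        open ≡-Reasoning
        regroup : ∀ x y → x * y * (1ℤ + x) ≡ y * (x + x * x)
        regroup = solve-∀
        expand : ∀ a b c d z → c * c * (d * d * (z * z) - + 4 * a * b) ≡
                               c * (d * d - + 4 * a * b * c) + c * d * d * (c * (z * z) - 1ℤ)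
        expand = solve-∀
        on-conic : ∀ z → M z ≈ 0ℤ → χ (Δ z) ≡ χ (c * D)
        on-conic z M≈0 = begin
          χ (Δ z)
            ≡⟨ χ-*-square c (Δ z) c≉0 ⟨
          χ (c * c * Δ z)
            ≡⟨ χ-cong (≈-trans (≈-reflexive (expand a b c d z)) (+*-≈0 (c * D) (c * d * d) cz²-1≈0)) ⟩
          χ (c * D) ∎
          where
          cz²-1≈0 : c * (z * z) - 1ℤ ≈ 0ℤ
          cz²-1≈0 = ∣⇒≈0 (p∣x-y (M≈0⇒cz²≈1 z M≈0))

      ∑𝟙[Δ≈0]χM : ∑[ z < p ] (𝟙[ Δ (+ z) ≈ 0ℤ ] * χ (M (+ z))) ≡ χ D * (χ a + χ b)
      ∑𝟙[Δ≈0]χM = begin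
        ∑[ z < p ] (𝟙[ Δ (+ z) ≈ 0ℤ ] * χ (M (+ z)))
          ≡⟨ ∑-cong p (λ z _ → 𝟙-*ˡ _ (χ (a * D)) (on-Δ≈0 (+ z))) ⟩
        ∑[ z < p ] (χ (a * D) * 𝟙[ Δ (+ z) ≈ 0ℤ ])
          ≡⟨ ∑-*ˡ p (χ (a * D)) _ ⟩
        χ (a * D) * ∑[ z < p ] 𝟙[ Δ (+ z) ≈ 0ℤ ]
          ≡⟨ cong (χ (a * D) *_) ∑𝟙[Δ≈0] ⟩
        χ (a * D) * (1ℤ + χ (+ 4 * a * b))
          ≡⟨ cong₂ (λ u v → u * (1ℤ + v)) (χ-* a D) χ[4ab] ⟩
        χ a * χ D * (1ℤ + χ a * χ b)
          ≡⟨ regroup (χ a) (χ b) (χ D) ⟩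
        χ D * (χ a + χ a * χ a * χ b)
          ≡⟨ cong (λ s → χ D * (χ a + s * χ b)) (χ²≡1 a≉0) ⟩
        χ D * (χ a + 1ℤ * χ b)
          ≡⟨ cong (λ s → χ D * (χ a + s)) (ℤP.*-identityˡ (χ b)) ⟩
        χ D * (χ a + χ b) ∎
        where
        open ≡-Reasoning
        regroup : ∀ x y w → x * w * (1ℤ + x * y) ≡ w * (x + x * x * y)
        regroup = solve-∀
        χ[4ab] : χ (+ 4 * a * b) ≡ χ a * χ b
        χ[4ab] = trans (cong χ (ℤP.*-assoc (+ 4) a b)) (trans (χ-*-square (+ 2) (a * b) 2≉0) (χ-* a b))
        ∑𝟙[Δ≈0] : ∑[ z < p ] 𝟙[ Δ (+ z) ≈ 0ℤ ] ≡ 1ℤ + χ (+ 4 * a * b)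
        ∑𝟙[Δ≈0] = begin
          ∑[ z < p ] 𝟙[ Δ (+ z) ≈ 0ℤ ]
            ≡⟨ ∑-cong p (λ z _ → 𝟙-cong (to (+ z)) (from (+ z))) ⟩
          ∑[ z < p ] 𝟙[ (d * + z + 0ℤ) * (d * + z + 0ℤ) ≈ + 4 * a * b ]
            ≡⟨ ∑-affine (λ x≈y → 𝟙-resp (*-cong x≈y x≈y) (≈-refl {+ 4 * a * b})) 0ℤ d≉0 ⟩
          roots (+ 4 * a * b)
            ≡⟨ roots≡1+χ (+ 4 * a * b) ⟩
          1ℤ + χ (+ 4 * a * b) ∎
          where
          shift : ∀ a b d z →
                  d * d * (z * z) - + 4 * a * b ≡ (d * z + 0ℤ) * (d * z + 0ℤ) - + 4 * a * b
          shift = solve-∀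
          to : ∀ z → Δ z ≈ 0ℤ → (d * z + 0ℤ) * (d * z + 0ℤ) ≈ + 4 * a * b
          to z Δ≈0 = congruent (subst (+ p ∣_) (shift a b d z) (≈0⇒∣ Δ≈0))
          from : ∀ z → (d * z + 0ℤ) * (d * z + 0ℤ) ≈ + 4 * a * b → Δ z ≈ 0ℤ
          from z d²z²≈4ab = ∣⇒≈0 (subst (+ p ∣_) (sym (shift a b d z)) (p∣x-y d²z²≈4ab))
        expand : ∀ a b c d z →
          d * d * (+ 4 * a * (1ℤ - c * (z * z))) ≡
          + 2 * + 2 * (a * (d * d - + 4 * a * b * c)) + - (+ 4 * a * c) * (d * d * (z * z) - + 4 * a * b)
        expand = solve-∀
        on-Δ≈0 : ∀ z → Δ z ≈ 0ℤ → χ (M z) ≡ χ (a * D)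
        on-Δ≈0 z Δ≈0 = begin
          χ (M z)
            ≡⟨ χ-*-square d (M z) d≉0 ⟨
          χ (d * d * M z)
            ≡⟨ χ-cong (≈-trans (≈-reflexive (expand a b c d z)) (+*-≈0 _ (- (+ 4 * a * c)) Δ≈0)) ⟩
          χ (+ 2 * + 2 * (a * D))
            ≡⟨ χ-*-square (+ 2) (a * D) 2≉0 ⟩
          χ (a * D) ∎

      ∑Γ : ∑[ z < p ] Γ (+ z) ≡ χ D * (χ c + 1ℤ) + χ D * (χ a + χ b)
      ∑Γ = trans (∑-+ p _ _) (cong₂ _+_ ∑𝟙[M≈0]χΔ ∑𝟙[Δ≈0]χM)

      ν-formula : + ν a b c d p ≡ + p * + p + + p * χ D * (+ 1 + χ a + χ b + χ c) + + 1
      ν-formula = begin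
        + ν a b c d p
          ≡⟨ count-triples _ p ⟩
        ∑[ x < p ] ∑[ y < p ] ∑[ z < p ] 𝟙 (divides? p (f a b c d (+ x) (+ y) (+ z)))
          ≡⟨ ∑³-reverse p _ ⟩
        ∑[ z < p ] ∑[ y < p ] ∑[ x < p ] 𝟙 (divides? p (f a b c d (+ x) (+ y) (+ z)))
          ≡⟨ ∑-cong p (λ z _ → ∑ₓᵧ (+ z)) ⟩
        ∑[ z < p ] (+ p - χ (Δ (+ z)) + + p * Γ (+ z))
          ≡⟨ trans (∑-+ p _ _) (cong₂ _+_ (∑-- p _ _) (∑-*ˡ p (+ p) _)) ⟩
        ∑[ _ < p ] (+ p) - ∑[ z < p ] χ (Δ (+ z)) + + p * ∑[ z < p ] Γ (+ z)
          ≡⟨ cong₂ _+_ (cong₂ _-_ (∑-const p (+ p)) ∑χΔ) (cong (_*_ (+ p)) ∑Γ) ⟩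
        + p * + p - -1ℤ + + p * (χ D * (χ c + 1ℤ) + χ D * (χ a + χ b))
          ≡⟨ collect (+ p) (χ a) (χ b) (χ c) (χ D) ⟩
        + p * + p + + p * χ D * (+ 1 + χ a + χ b + χ c) + + 1 ∎
        where
        open ≡-Reasoning
        collect : ∀ P a b c D →
                  P * P - -1ℤ + P * (D * (c + 1ℤ) + D * (a + b)) ≡ P * P + P * D * (+ 1 + a + b + c) + + 1
        collect = solve-∀

-- Only p ∤ 2abcd(d² − 4abc) enters the point count.
lemma7p1 : (a b c d : ℕ) →
    SquareFree a → SquareFree b → SquareFree c → SquareFree d →
    + 4 * + a * + b * + c - + d * + d ≢ + 0 →
    a ℕD.∣ d → b ℕD.∣ d → c ℕD.∣ d →
    ¬ (∃ λ (k : ℤ) → k * k ≡ + d * + d - + 4 * + a * + b * + c) →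
    ¬ (∃ λ (k : ℤ) → k * k ≡ + a * (+ d * + d - + 4 * + a * + b * + c)) →
    ¬ (∃ λ (k : ℤ) → k * k ≡ + b * (+ d * + d - + 4 * + a * + b * + c)) →
    ¬ (∃ λ (k : ℤ) → k * k ≡ + c * (+ d * + d - + 4 * + a * + b * + c)) →
    (p : ℕ) → Prime p →
    ¬ ((+ p) ℤD.∣ (+ 2 * + a * + b * + c * + d * (+ d * + d - + 4 * + a * + b * + c))) →
    + (ν (+ a) (+ b) (+ c) (+ d) p) ≡
      + p * + p
      + + p * legendre (+ d * + d - + 4 * + a * + b * + c) p
            * (+ 1 + legendre (+ a) p + legendre (+ b) p + legendre (+ c) p)
      + + 1
lemma7p1 a b c d _ _ _ _ _ _ _ _ _ _ _ _ p p-prime p∤N =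
  Surface.ν-formula 2≉0 (+ a) (+ b) (+ c) (+ d) a≉0 b≉0 c≉0 d≉0 D≉0
  where
  open ModuloPrime p p-prime
  D : ℤ
  D = + d * + d - + 4 * + a * + b * + c
  N≉0 : + 2 * + a * + b * + c * + d * D ≉ 0ℤ
  N≉0 = p∤N ∘ ∣⇒∣ᵤ ∘ ≈0⇒∣
  2≉0 : + 2 ≉ 0ℤ
  2≉0 2≈0 = N≉0 (*-≈0ˡ D (*-≈0ˡ (+ d) (*-≈0ˡ (+ c) (*-≈0ˡ (+ b) (*-≈0ˡ (+ a) 2≈0)))))
  a≉0 : + a ≉ 0ℤ
  a≉0 a≈0 = N≉0 (*-≈0ˡ D (*-≈0ˡ (+ d) (*-≈0ˡ (+ c) (*-≈0ˡ (+ b) (*-≈0ʳ (+ 2) a≈0)))))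
  b≉0 : + b ≉ 0ℤ
  b≉0 b≈0 = N≉0 (*-≈0ˡ D (*-≈0ˡ (+ d) (*-≈0ˡ (+ c) (*-≈0ʳ (+ 2 * + a) b≈0))))
  c≉0 : + c ≉ 0ℤ
  c≉0 c≈0 = N≉0 (*-≈0ˡ D (*-≈0ˡ (+ d) (*-≈0ʳ (+ 2 * + a * + b) c≈0)))
  d≉0 : + d ≉ 0ℤ
  d≉0 d≈0 = N≉0 (*-≈0ˡ D (*-≈0ʳ (+ 2 * + a * + b * + c) d≈0))
  D≉0 : D ≉ 0ℤ
  D≉0 D≈0 = N≉0 (*-≈0ʳ (+ 2 * + a * + b * + c * + d) D≈0)
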